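{- For every $n\ge1$, the transitive tournament $I_n$ has exactly $F_n$ matching orderings, where $F_0=F_1=1$ and $F_i=F_{i-1}+F_{i-2}$ for $i\ge2$.
   Context: A tournament has exactly one directed edge between any two distinct vertices. $I_n$ is the transitive tournament on $n$ vertices (vertices $v_1,\dots,v_n$ with $v_i\to v_j$ whenever $i<j$). For an ordering of the vertex set, a backedge is an edge from a later vertex to an earlier one; a matching ordering is an ordering in which every vertex is an end of at most one backedge. -}

module Defs where

open import Data.Nat using (ℕ; zero; suc; _+_)
open import Data.Fin using (Fin; _<_; _<?_)
open import Data.Fin.Properties using (all?; _≟_)
open import Data.Vec using (Vec; lookup)
open import Data.Product using (Σ; _×_)
open import Data.Sum using (_⊎_)
open import Relation.Nullary using (Dec)
open import Relation.Nullary.Decidable using (True; _×-dec_; _⊎-dec_; _→-dec_)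
open import Relation.Binary.PropositionalEquality using (_≡_)

F : ℕ → ℕ
F zero = 1
F (suc zero) = 1
F (suc (suc i)) = F (suc i) + F i

-- The transitive tournament I_n on vertices Fin n (v_i ↦ i):
-- edge u → w  iff  u < w.
Iₙ-edge : ∀ {n} → Fin n → Fin n → Set
Iₙ-edge u w = u < w

Iₙ-edge? : ∀ {n} (u w : Fin n) → Dec (Iₙ-edge u w)
Iₙ-edge? u w = u <? w

-- An ordering of the vertex set of I_n: a listing  o = (o[0], …, o[n-1])
-- of vertices in which every vertex appears exactly once (the listing is
-- injective; since it has length n it is a bijection).
IsOrdering : ∀ {n} → Vec (Fin n) n → Set
IsOrdering {n} o = (p q : Fin n) → lookup o p ≡ lookup o q → p ≡ q

IsOrdering? : ∀ {n} (o : Vec (Fin n) n) → Dec (IsOrdering o)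
IsOrdering? o = all? λ p → all? λ q → (lookup o p ≟ lookup o q) →-dec (p ≟ q)

Backedge : ∀ {n} → Vec (Fin n) n → Fin n → Fin n → Set
Backedge o p q = p < q × Iₙ-edge (lookup o q) (lookup o p)

Backedge? : ∀ {n} (o : Vec (Fin n) n) (p q : Fin n) → Dec (Backedge o p q)
Backedge? o p q = (p <? q) ×-dec Iₙ-edge? (lookup o q) (lookup o p)

IncidentBackedge : ∀ {n} → Vec (Fin n) n → Fin n → Fin n → Set
IncidentBackedge o p q = Backedge o p q ⊎ Backedge o q p

IncidentBackedge? : ∀ {n} (o : Vec (Fin n) n) (p q : Fin n) → Dec (IncidentBackedge o p q)
IncidentBackedge? o p q = Backedge? o p q ⊎-dec Backedge? o q p

IsMatchingOrdering : ∀ {n} → Vec (Fin n) n → Set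
IsMatchingOrdering {n} o = IsOrdering o ×
  ((p q r : Fin n) → IncidentBackedge o p q → IncidentBackedge o p r → q ≡ r)

IsMatchingOrdering? : ∀ {n} (o : Vec (Fin n) n) → Dec (IsMatchingOrdering o)
IsMatchingOrdering? o = IsOrdering? o ×-dec
  (all? λ p → all? λ q → all? λ r →
     IncidentBackedge? o p q →-dec (IncidentBackedge? o p r →-dec (q ≟ r)))

-- The set of matching orderings of I_n (membership witnessed by the
-- proof-irrelevant  True  of the decision procedure).
MatchingOrderings : ℕ → Set
MatchingOrderings n = Σ (Vec (Fin n) n) (λ o → True (IsMatchingOrdering? o))

-- In a matching ordering of I_(n+2) the first vertex has a backedge to every smaller vertex, so it
-- is v₀ or v₁; and if it is v₁, then v₀ comes second, since otherwise v₀ would have backedges to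
-- both of the first two vertices.  No backedge joins the initial block v₀ (resp. v₁ v₀) to the
-- rest, which is a matching ordering of the remaining vertices, i.e. of a copy of I_(n+1)
-- (resp. I_n); conversely every such ordering extends.  So the counts satisfy F's recursion.
module Submission where

open import Defs
open import Data.Nat using (ℕ; zero; suc; _+_; _≤_; z<s; s<s) renaming (_<_ to _<ℕ_)
import Data.Nat.Properties as ℕ
open import Data.Fin using (Fin; zero; suc; toℕ; _↑ˡ_; _↑ʳ_; _<_; punchOut)
open import Data.Fin.Properties
  using (any?; _≟_; <-cmp; <-irrefl; <-asym; suc-injective; toℕ<n; toℕ-↑ˡ; toℕ-↑ʳ;
         ↑ˡ-injective; ↑ʳ-injective; injective⇒≤; punchOut-injective; +↔⊎)
open import Data.Vec using (Vec; []; _∷_; lookup; map; _++_)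
open import Data.Vec.Properties using (lookup-map; lookup-++ˡ; lookup-++ʳ; ∷-injectiveˡ; ∷-injectiveʳ)
open import Data.Product using (Σ-syntax; ∃; _,_; proj₁; proj₂)
open import Data.Sum using (_⊎_; inj₁; inj₂; [_,_])
open import Data.Sum.Function.Propositional using (_⊎-⇔_; _⊎-↔_)
open import Data.Bool.Properties using (T-irrelevant)
open import Data.Unit using (tt)
open import Data.Empty using (⊥-elim)
open import Relation.Nullary using (¬_; yes; no; contradiction)
open import Relation.Nullary.Decidable using (toWitness; fromWitness)
open import Relation.Binary.Definitions using (tri<; tri≈; tri>)
open import Relation.Binary.PropositionalEquality hiding ([_])
open import Function.Base using (_∘_)
open import Function.Bundles using (_↔_; _⇔_; mk↔ₛ′; mk⇔; Equivalence)
open import Function.Properties.Inverse using (↔-trans; ↔-sym)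

open Equivalence using (to; from)

ordering-surjective : ∀ {n} (o : Vec (Fin n) n) → IsOrdering o → ∀ v → ∃ λ p → lookup o p ≡ v
ordering-surjective {suc m} o o-inj v with any? (λ p → lookup o p ≟ v)
... | yes hit = hit
... | no miss = contradiction (injective⇒≤ squeeze-injective) ℕ.1+n≰n
  where
  v≢o[_] : ∀ p → v ≢ lookup o p
  v≢o[ p ] v≡o[p] = miss (p , sym v≡o[p])
  squeeze : Fin (suc m) → Fin m
  squeeze p = punchOut v≢o[ p ]
  squeeze-injective : ∀ {p q} → squeeze p ≡ squeeze q → p ≡ q
  squeeze-injective = o-inj _ _ ∘ punchOut-injective v≢o[ _ ] v≢o[ _ ]

IsOrderEmbedding : ∀ {m n} → (Fin m → Fin n) → Set
IsOrderEmbedding f = ∀ {x y} → x < y ⇔ f x < f y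

orderEmbedding-injective : ∀ {m n} {f : Fin m → Fin n} {x y} → IsOrderEmbedding f → f x ≡ f y → x ≡ y
orderEmbedding-injective {x = x} {y} f-emb fx≡fy with <-cmp x y
... | tri< x<y _ _ = contradiction (to f-emb x<y) (<-irrefl fx≡fy)
... | tri≈ _ x≡y _ = x≡y
... | tri> _ _ y<x = contradiction (to f-emb y<x) (<-irrefl (sym fx≡fy))

↑ˡ-isOrderEmbedding : ∀ {m} n → IsOrderEmbedding {m} (_↑ˡ n)
↑ˡ-isOrderEmbedding n {x} {y} = mk⇔
  (subst₂ _<ℕ_ (sym (toℕ-↑ˡ x n)) (sym (toℕ-↑ˡ y n)))
  (subst₂ _<ℕ_ (toℕ-↑ˡ x n) (toℕ-↑ˡ y n))

↑ʳ-isOrderEmbedding : ∀ m {n} → IsOrderEmbedding {n} (m ↑ʳ_)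
↑ʳ-isOrderEmbedding m {n} {x} {y} = mk⇔
  (subst₂ _<ℕ_ (sym (toℕ-↑ʳ m x)) (sym (toℕ-↑ʳ m y)) ∘ ℕ.+-monoʳ-< m)
  (ℕ.+-cancelˡ-< m _ _ ∘ subst₂ _<ℕ_ (toℕ-↑ʳ m x) (toℕ-↑ʳ m y))

module _ {m n} {o : Vec (Fin n) n} {t : Vec (Fin m) m} {ι κ : Fin m → Fin n}
         (ι-emb : IsOrderEmbedding ι) (κ-emb : IsOrderEmbedding κ)
         (o∘ι≡κ∘t : ∀ p → lookup o (ι p) ≡ κ (lookup t p)) where

  backedge-embedding : ∀ {p q} → Backedge t p q ⇔ Backedge o (ι p) (ι q)
  backedge-embedding {p} {q} = mk⇔
    (λ (p<q , t[q]<t[p]) →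
      to ι-emb p<q , subst₂ _<_ (sym (o∘ι≡κ∘t q)) (sym (o∘ι≡κ∘t p)) (to κ-emb t[q]<t[p]))
    (λ (ιp<ιq , o[ιq]<o[ιp]) →
      from ι-emb ιp<ιq , from κ-emb (subst₂ _<_ (o∘ι≡κ∘t q) (o∘ι≡κ∘t p) o[ιq]<o[ιp]))

  incidentBackedge-embedding : ∀ {p q} → IncidentBackedge t p q ⇔ IncidentBackedge o (ι p) (ι q)
  incidentBackedge-embedding = backedge-embedding ⊎-⇔ backedge-embedding

  isMatchingOrdering-restrict : IsMatchingOrdering o → IsMatchingOrdering t
  isMatchingOrdering-restrict (o-inj , o-match) = t-inj , t-match
    where
    ι-injective : ∀ {x y} → ι x ≡ ι y → x ≡ y
    ι-injective = orderEmbedding-injective ι-emb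
    t-inj : IsOrdering t
    t-inj p q t[p]≡t[q] = ι-injective (o-inj (ι p) (ι q) (begin
      lookup o (ι p)  ≡⟨ o∘ι≡κ∘t p ⟩
      κ (lookup t p)  ≡⟨ cong κ t[p]≡t[q] ⟩
      κ (lookup t q)  ≡⟨ o∘ι≡κ∘t q ⟨
      lookup o (ι q)  ∎))
      where open ≡-Reasoning
    t-match : ∀ p q r → IncidentBackedge t p q → IncidentBackedge t p r → q ≡ r
    t-match p q r pq pr = ι-injective
      (o-match (ι p) (ι q) (ι r) (to incidentBackedge-embedding pq) (to incidentBackedge-embedding pr))

_⊕_ : ∀ {m n} → Vec (Fin m) m → Vec (Fin n) n → Vec (Fin (m + n)) (m + n)
_⊕_ {m} {n} a b = map (_↑ˡ n) a ++ map (m ↑ʳ_) b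

data Split m n : Fin (m + n) → Set where
  left  : (i : Fin m) → Split m n (i ↑ˡ n)
  right : (j : Fin n) → Split m n (m ↑ʳ j)

split : ∀ m n (x : Fin (m + n)) → Split m n x
split zero    n x = right x
split (suc m) n zero = left zero
split (suc m) n (suc x) with split m n x
... | left i  = left (suc i)
... | right j = right j

↑ˡ<↑ʳ : ∀ {m n} (i : Fin m) (j : Fin n) → i ↑ˡ n < m ↑ʳ j
↑ˡ<↑ʳ {m} {n} i j =
  subst₂ _<ℕ_ (sym (toℕ-↑ˡ i n)) (sym (toℕ-↑ʳ m j)) (ℕ.<-≤-trans (toℕ<n i) (ℕ.m≤m+n m (toℕ j)))

↑ˡ≢↑ʳ : ∀ {m n} (i : Fin m) (j : Fin n) → i ↑ˡ n ≢ m ↑ʳ j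
↑ˡ≢↑ʳ i j i≡j = <-irrefl i≡j (↑ˡ<↑ʳ i j)

module _ {m n} (a : Vec (Fin m) m) (b : Vec (Fin n) n) where

  lookup-⊕ˡ : ∀ i → lookup (a ⊕ b) (i ↑ˡ n) ≡ lookup a i ↑ˡ n
  lookup-⊕ˡ i = trans (lookup-++ˡ (map (_↑ˡ n) a) (map (m ↑ʳ_) b) i) (lookup-map i (_↑ˡ n) a)

  lookup-⊕ʳ : ∀ j → lookup (a ⊕ b) (m ↑ʳ j) ≡ m ↑ʳ lookup b j
  lookup-⊕ʳ j = trans (lookup-++ʳ (map (_↑ˡ n) a) (map (m ↑ʳ_) b) j) (lookup-map j (m ↑ʳ_) b)

  incidentBackedge-⊕ˡ : ∀ {i i′} → IncidentBackedge a i i′ ⇔ IncidentBackedge (a ⊕ b) (i ↑ˡ n) (i′ ↑ˡ n)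
  incidentBackedge-⊕ˡ =
    incidentBackedge-embedding {o = a ⊕ b} {t = a} (↑ˡ-isOrderEmbedding n) (↑ˡ-isOrderEmbedding n) lookup-⊕ˡ

  incidentBackedge-⊕ʳ : ∀ {j j′} → IncidentBackedge b j j′ ⇔ IncidentBackedge (a ⊕ b) (m ↑ʳ j) (m ↑ʳ j′)
  incidentBackedge-⊕ʳ =
    incidentBackedge-embedding {o = a ⊕ b} {t = b} (↑ʳ-isOrderEmbedding m) (↑ʳ-isOrderEmbedding m) lookup-⊕ʳ

  ¬backedge-⊕-left-right : ∀ i j → ¬ Backedge (a ⊕ b) (i ↑ˡ n) (m ↑ʳ j)
  ¬backedge-⊕-left-right i j (_ , later<earlier) =
    <-asym (↑ˡ<↑ʳ (lookup a i) (lookup b j)) (subst₂ _<_ (lookup-⊕ʳ j) (lookup-⊕ˡ i) later<earlier)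

  ¬backedge-⊕-right-left : ∀ i j → ¬ Backedge (a ⊕ b) (m ↑ʳ j) (i ↑ˡ n)
  ¬backedge-⊕-right-left i j (j<i , _) = <-asym (↑ˡ<↑ʳ i j) j<i

  ¬incidentBackedge-⊕-left-right : ∀ i j → ¬ IncidentBackedge (a ⊕ b) (i ↑ˡ n) (m ↑ʳ j)
  ¬incidentBackedge-⊕-left-right i j = [ ¬backedge-⊕-left-right i j , ¬backedge-⊕-right-left i j ]

  ¬incidentBackedge-⊕-right-left : ∀ i j → ¬ IncidentBackedge (a ⊕ b) (m ↑ʳ j) (i ↑ˡ n)
  ¬incidentBackedge-⊕-right-left i j = [ ¬backedge-⊕-right-left i j , ¬backedge-⊕-left-right i j ]

  ⊕-isOrdering : IsOrdering a → IsOrdering b → IsOrdering (a ⊕ b)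
  ⊕-isOrdering a-inj b-inj x y o[x]≡o[y] with split m n x | split m n y
  ... | left i  | left i′  = cong (_↑ˡ n) (a-inj i i′ (↑ˡ-injective n _ _
    (trans (sym (lookup-⊕ˡ i)) (trans o[x]≡o[y] (lookup-⊕ˡ i′)))))
  ... | left i  | right j  = ⊥-elim (↑ˡ≢↑ʳ _ _
    (trans (sym (lookup-⊕ˡ i)) (trans o[x]≡o[y] (lookup-⊕ʳ j))))
  ... | right j | left i   = ⊥-elim (↑ˡ≢↑ʳ _ _
    (trans (sym (lookup-⊕ˡ i)) (trans (sym o[x]≡o[y]) (lookup-⊕ʳ j))))
  ... | right j | right j′ = cong (m ↑ʳ_) (b-inj j j′ (↑ʳ-injective m _ _
    (trans (sym (lookup-⊕ʳ j)) (trans o[x]≡o[y] (lookup-⊕ʳ j′)))))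

  ⊕-isMatchingOrdering : IsMatchingOrdering a → IsMatchingOrdering b → IsMatchingOrdering (a ⊕ b)
  ⊕-isMatchingOrdering (a-inj , a-match) (b-inj , b-match) = ⊕-isOrdering a-inj b-inj , match
    where
    match : ∀ x y z → IncidentBackedge (a ⊕ b) x y → IncidentBackedge (a ⊕ b) x z → y ≡ z
    match x y z xy xz with split m n x | split m n y | split m n z
    ... | left i  | left i′  | left i″  =
      cong (_↑ˡ n) (a-match i i′ i″ (from incidentBackedge-⊕ˡ xy) (from incidentBackedge-⊕ˡ xz))
    ... | left i  | left _   | right j  = ⊥-elim (¬incidentBackedge-⊕-left-right i j xz)
    ... | left i  | right j  | _        = ⊥-elim (¬incidentBackedge-⊕-left-right i j xy)
    ... | right j | left i   | _        = ⊥-elim (¬incidentBackedge-⊕-right-left i j xy)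
    ... | right j | right _  | left i   = ⊥-elim (¬incidentBackedge-⊕-right-left i j xz)
    ... | right j | right j′ | right j″ =
      cong (m ↑ʳ_) (b-match j j′ j″ (from incidentBackedge-⊕ʳ xy) (from incidentBackedge-⊕ʳ xz))

  ⊕-isMatchingOrderingʳ : IsMatchingOrdering (a ⊕ b) → IsMatchingOrdering b
  ⊕-isMatchingOrderingʳ =
    isMatchingOrdering-restrict {o = a ⊕ b} {t = b} (↑ʳ-isOrderEmbedding m) (↑ʳ-isOrderEmbedding m) lookup-⊕ʳ

map-preimage : ∀ {A B : Set} {k} (f : A → B) (v : Vec B k) →
               (∀ p → ∃ λ x → f x ≡ lookup v p) → ∃ λ u → map f u ≡ v
map-preimage f []      _ = [] , refl
map-preimage f (y ∷ v) h with h zero | map-preimage f v (h ∘ suc)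
... | x , fx≡y | u , map-f-u≡v = x ∷ u , cong₂ _∷_ fx≡y map-f-u≡v

map-injective : ∀ {A B : Set} {k} {f : A → B} → (∀ {x y} → f x ≡ f y → x ≡ y) →
                {u v : Vec A k} → map f u ≡ map f v → u ≡ v
map-injective f-inj {[]}    {[]}    _  = refl
map-injective f-inj {x ∷ u} {y ∷ v} eq =
  cong₂ _∷_ (f-inj (∷-injectiveˡ eq)) (map-injective f-inj (∷-injectiveʳ eq))

↑ʳ-preimage : ∀ {m n} (x : Fin (m + n)) → (∀ i → x ≢ i ↑ˡ n) → ∃ λ j → m ↑ʳ j ≡ x
↑ʳ-preimage {m} {n} x x∉↑ˡ with split m n x
... | left i  = ⊥-elim (x∉↑ˡ i refl)
... | right j = j , refl

ordering-suffix-↑ʳ : ∀ {m n} (a : Vec (Fin m) m) (rest : Vec (Fin (m + n)) n) → IsOrdering a →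
                     IsOrdering (map (_↑ˡ n) a ++ rest) → ∃ λ b → map (m ↑ʳ_) b ≡ rest
ordering-suffix-↑ʳ {m} {n} a rest a-inj o-inj =
  map-preimage (m ↑ʳ_) rest (λ p → ↑ʳ-preimage (lookup rest p) (rest[p]≢↑ˡ p))
  where
  o = map (_↑ˡ n) a ++ rest
  rest[p]≢↑ˡ : ∀ p i → lookup rest p ≢ i ↑ˡ n
  rest[p]≢↑ˡ p i rest[p]≡i with ordering-surjective a a-inj i
  ... | q , a[q]≡i = ↑ˡ≢↑ʳ q p (o-inj (q ↑ˡ n) (m ↑ʳ p) (begin
    lookup o (q ↑ˡ n)         ≡⟨ lookup-++ˡ (map (_↑ˡ n) a) rest q ⟩
    lookup (map (_↑ˡ n) a) q  ≡⟨ lookup-map q (_↑ˡ n) a ⟩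
    lookup a q ↑ˡ n           ≡⟨ cong (_↑ˡ n) a[q]≡i ⟩
    i ↑ˡ n                    ≡⟨ rest[p]≡i ⟨
    lookup rest p             ≡⟨ lookup-++ʳ (map (_↑ˡ n) a) rest p ⟨
    lookup o (m ↑ʳ p)         ∎))
    where open ≡-Reasoning

matchingOrderings-≡ : ∀ {n} {x y : MatchingOrderings n} → proj₁ x ≡ proj₁ y → x ≡ y
matchingOrderings-≡ {x = o , w} {.o , w′} refl = cong (o ,_) (T-irrelevant w w′)

matchingOrdering-suffix : ∀ {m n} (a : Vec (Fin m) m) → IsOrdering a → (rest : Vec (Fin (m + n)) n) →
                          IsMatchingOrdering (map (_↑ˡ n) a ++ rest) →
                          Σ[ b ∈ MatchingOrderings n ] map (m ↑ʳ_) (proj₁ b) ≡ rest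
matchingOrdering-suffix a a-inj rest o-mo with ordering-suffix-↑ʳ a rest a-inj (proj₁ o-mo)
... | b , refl = (b , fromWitness (⊕-isMatchingOrderingʳ a b o-mo)) , refl

¬isMatchingOrdering-head≥2 : ∀ {n} {v : Fin n} {rest : Vec (Fin (2 + n)) (1 + n)} →
                             ¬ IsMatchingOrdering (suc (suc v) ∷ rest)
¬isMatchingOrdering-head≥2 {v = v} {rest} (o-inj , o-match)
  with ordering-surjective (suc (suc v) ∷ rest) o-inj zero
     | ordering-surjective (suc (suc v) ∷ rest) o-inj (suc zero)
... | zero , () | _
... | suc _ , _ | zero , ()
... | suc p , rest[p]≡0 | suc q , rest[q]≡1 = contradiction (begin
  zero           ≡⟨ rest[p]≡0 ⟨
  lookup rest p  ≡⟨ cong (lookup rest) (suc-injective p≡q) ⟩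
  lookup rest q  ≡⟨ rest[q]≡1 ⟩
  suc zero       ∎) λ ()
  where
  open ≡-Reasoning
  p≡q : suc p ≡ suc q
  p≡q = o-match zero (suc p) (suc q)
    (inj₁ (z<s , subst (_< suc (suc v)) (sym rest[p]≡0) z<s))
    (inj₁ (z<s , subst (_< suc (suc v)) (sym rest[q]≡1) (s<s z<s)))

¬isMatchingOrdering-head1-second≥1 : ∀ {n} {x : Fin (1 + n)} {rest : Vec (Fin (2 + n)) n} →
                                     ¬ IsMatchingOrdering (suc zero ∷ suc x ∷ rest)
¬isMatchingOrdering-head1-second≥1 {x = x} {rest} (o-inj , o-match)
  with ordering-surjective (suc zero ∷ suc x ∷ rest) o-inj zero
... | zero , ()
... | suc zero , ()
... | suc (suc p) , rest[p]≡0 = contradiction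
  (o-match (suc (suc p)) zero (suc zero)
    (inj₂ (z<s , subst (_< lookup (suc zero ∷ suc x ∷ rest) zero) (sym rest[p]≡0) z<s))
    (inj₂ (s<s z<s , subst (_< suc x) (sym rest[p]≡0) z<s))) λ ()

[v₀] : Vec (Fin 1) 1
[v₀] = zero ∷ []

[v₁v₀] : Vec (Fin 2) 2
[v₁v₀] = suc zero ∷ zero ∷ []

[v₀]-isMatchingOrdering : IsMatchingOrdering [v₀]
[v₀]-isMatchingOrdering = toWitness {a? = IsMatchingOrdering? [v₀]} tt

[v₁v₀]-isMatchingOrdering : IsMatchingOrdering [v₁v₀]
[v₁v₀]-isMatchingOrdering = toWitness {a? = IsMatchingOrdering? [v₁v₀]} tt

matchingOrderings-split : ∀ n →
  MatchingOrderings (2 + n) ↔ (MatchingOrderings (1 + n) ⊎ MatchingOrderings n)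
matchingOrderings-split n =
  mk↔ₛ′ (λ (o , w) → suffix o (toWitness w)) prepend suffix∘prepend prepend∘suffix
  where
  after-v₀ : ∀ rest → IsMatchingOrdering (zero ∷ rest) →
             Σ[ b ∈ MatchingOrderings (1 + n) ] map suc (proj₁ b) ≡ rest
  after-v₀ = matchingOrdering-suffix [v₀] (proj₁ [v₀]-isMatchingOrdering)

  after-v₁v₀ : ∀ rest → IsMatchingOrdering (suc zero ∷ zero ∷ rest) →
               Σ[ b ∈ MatchingOrderings n ] map (2 ↑ʳ_) (proj₁ b) ≡ rest
  after-v₁v₀ = matchingOrdering-suffix [v₁v₀] (proj₁ [v₁v₀]-isMatchingOrdering)

  suffix : ∀ o → IsMatchingOrdering o → MatchingOrderings (1 + n) ⊎ MatchingOrderings n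
  suffix (zero ∷ rest)            o-mo = inj₁ (proj₁ (after-v₀ rest o-mo))
  suffix (suc zero ∷ zero ∷ rest) o-mo = inj₂ (proj₁ (after-v₁v₀ rest o-mo))
  suffix (suc zero ∷ suc _ ∷ _)   o-mo = ⊥-elim (¬isMatchingOrdering-head1-second≥1 o-mo)
  suffix (suc (suc _) ∷ _)        o-mo = ⊥-elim (¬isMatchingOrdering-head≥2 o-mo)

  prepend : MatchingOrderings (1 + n) ⊎ MatchingOrderings n → MatchingOrderings (2 + n)
  prepend (inj₁ (b , w)) =
    [v₀] ⊕ b , fromWitness (⊕-isMatchingOrdering [v₀] b [v₀]-isMatchingOrdering (toWitness w))
  prepend (inj₂ (b , w)) =
    [v₁v₀] ⊕ b , fromWitness (⊕-isMatchingOrdering [v₁v₀] b [v₁v₀]-isMatchingOrdering (toWitness w))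

  suffix∘prepend : ∀ y → suffix (proj₁ (prepend y)) (toWitness (proj₂ (prepend y))) ≡ y
  suffix∘prepend (inj₁ (b , _)) =
    cong inj₁ (matchingOrderings-≡ (map-injective suc-injective (proj₂ (after-v₀ (map suc b) _))))
  suffix∘prepend (inj₂ (b , _)) =
    cong inj₂ (matchingOrderings-≡
      (map-injective (↑ʳ-injective 2 _ _) (proj₂ (after-v₁v₀ (map (2 ↑ʳ_) b) _))))

  prepend∘suffix : ∀ x → prepend (suffix (proj₁ x) (toWitness (proj₂ x))) ≡ x
  prepend∘suffix (zero ∷ rest , w) =
    matchingOrderings-≡ (cong (zero ∷_) (proj₂ (after-v₀ rest (toWitness w))))
  prepend∘suffix (suc zero ∷ zero ∷ rest , w) =
    matchingOrderings-≡ (cong (λ r → suc zero ∷ zero ∷ r) (proj₂ (after-v₁v₀ rest (toWitness w))))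
  prepend∘suffix (suc zero ∷ suc _ ∷ _ , w) = ⊥-elim (¬isMatchingOrdering-head1-second≥1 (toWitness w))
  prepend∘suffix (suc (suc _) ∷ _ , w)      = ⊥-elim (¬isMatchingOrdering-head≥2 (toWitness w))

singleton↔Fin1 : ∀ {A : Set} (x : A) → (∀ y → y ≡ x) → A ↔ Fin 1
singleton↔Fin1 x unique = mk↔ₛ′ (λ _ → zero) (λ _ → x) (λ { zero → refl }) (sym ∘ unique)

matchingOrderings↔Fin-F : ∀ n → MatchingOrderings n ↔ Fin (F n)
matchingOrderings↔Fin-F zero          = singleton↔Fin1 ([] , tt) (λ { ([] , _) → matchingOrderings-≡ refl })
matchingOrderings↔Fin-F (suc zero)    =
  singleton↔Fin1 (zero ∷ [] , tt) (λ { (zero ∷ [] , _) → matchingOrderings-≡ refl })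
matchingOrderings↔Fin-F (suc (suc n)) = ↔-trans (matchingOrderings-split n)
  (↔-trans (matchingOrderings↔Fin-F (suc n) ⊎-↔ matchingOrderings↔Fin-F n) (↔-sym +↔⊎))

corollary5p7 : (n : ℕ) → 1 ≤ n → MatchingOrderings n ↔ Fin (F n)
corollary5p7 n _ = matchingOrderings↔Fin-F n
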